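{- A connected local tournament is twin-free.
   Context: All digraphs are finite and loopless. A digraph is simple if there is at most one arc between any two vertices; it is connected if its underlying undirected graph is connected. A tournament is a digraph with exactly one arc between every pair of distinct vertices. A local tournament is a simple digraph in which, for every vertex $v$, both its in-neighbourhood $N^-(v)$ and its out-neighbourhood $N^+(v)$ induce tournaments. With $N^-[v]=N^-(v)\cup\{v\}$, two distinct vertices $x,y$ are twins if $N^-(x)=N^-(y)$ or $N^-[x]=N^-[y]$; a digraph is twin-free if it has no pair of twins. -}

module Defs where

open import Data.Nat using (ℕ)
open import Data.Fin using (Fin)
open import Data.Product using (_×_)
open import Data.Sum using (_⊎_)
open import Relation.Nullary using (¬_)
open import Relation.Binary.PropositionalEquality using (_≡_; _≢_)
open import Function.Bundles using (_⇔_)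

record Digraph : Set₁ where
  field
    n        : ℕ
    Arc      : Fin n → Fin n → Set
    loopless : ∀ v → ¬ Arc v v

module _ (D : Digraph) where
  open Digraph D

  Simple : Set
  Simple = ∀ u v → ¬ (Arc u v × Arc v u)

  Adj : Fin n → Fin n → Set
  Adj u v = Arc u v ⊎ Arc v u

  data Walk : Fin n → Fin n → Set where
    here  : ∀ {u} → Walk u u
    step  : ∀ {u v w} → Adj u v → Walk v w → Walk u w

  Connected : Set
  Connected = ∀ u v → Walk u v

  InducesTournament : (Fin n → Set) → Set
  InducesTournament S =
    ∀ x y → S x → S y → x ≢ y →
      (Arc x y × ¬ Arc y x) ⊎ (Arc y x × ¬ Arc x y)

  InNbr : Fin n → Fin n → Set
  InNbr v z = Arc z v

  OutNbr : Fin n → Fin n → Set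
  OutNbr v z = Arc v z

  ClosedInNbr : Fin n → Fin n → Set
  ClosedInNbr v z = Arc z v ⊎ z ≡ v

  LocalTournament : Set
  LocalTournament =
    Simple × (∀ v → InducesTournament (InNbr v) × InducesTournament (OutNbr v))

  Twins : Fin n → Fin n → Set
  Twins x y = x ≢ y ×
    ((∀ z → InNbr x z ⇔ InNbr y z) ⊎ (∀ z → ClosedInNbr x z ⇔ ClosedInNbr y z))

  TwinFree : Set
  TwinFree = ∀ x y → ¬ Twins x y

{-# OPTIONS --safe #-}
module Submission where

-- Equal open in-neighbourhoods make x and y two distinct sources: an in-neighbour of x
-- would be an in-neighbour of y too, so its out-tournament contains an arc between x and y,
-- forcing a loop. But in a connected digraph whose in-neighbourhoods are tournaments a source
-- reaches every vertex by a directed path, so a second source cannot exist. Equal closed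
-- in-neighbourhoods give the arcs x → y and y → x, against simplicity.

open import Defs
open import Data.Fin using (Fin; _≟_)
open import Data.Product using (_×_; _,_; proj₁; proj₂)
open import Data.Sum using (inj₁; inj₂)
open import Data.Empty using (⊥-elim)
open import Relation.Nullary using (¬_; yes; no)
open import Relation.Binary.PropositionalEquality using (_≡_; _≢_; ≢-sym; refl; sym)
open import Function.Bundles using (_⇔_; Equivalence)
open import Function.Construct.Symmetry using (⇔-sym)

module _ (D : Digraph) where
  open Digraph D
  open Equivalence

  Source : Fin n → Set
  Source s = ∀ z → ¬ Arc z s

  InTournaments : Set
  InTournaments = ∀ v → InducesTournament D (InNbr D v)

  OutTournaments : Set
  OutTournaments = ∀ v → InducesTournament D (OutNbr D v)

  infix 4 _⇝_
  data _⇝_ (s : Fin n) : Fin n → Set where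
    ⇝-refl : s ⇝ s
    _▻_    : ∀ {u v} → s ⇝ u → Arc u v → s ⇝ v

  module _ (inTournaments : InTournaments) {s : Fin n} (source : Source s) where

    -- The last arc u → v of the path and w → v lie in the tournament N⁻(v): either
    -- w → u and we recurse on the shorter path to u, or u → w extends that path.
    ⇝-closed-under-InNbr : ∀ {v w} → s ⇝ v → Arc w v → s ⇝ w
    ⇝-closed-under-InNbr ⇝-refl w→s = ⊥-elim (source _ w→s)
    ⇝-closed-under-InNbr {v} {w} (_▻_ {u} s⇝u u→v) w→v with w ≟ u
    ... | yes refl = s⇝u
    ... | no w≢u with inTournaments v w u w→v u→v w≢u
    ...   | inj₁ (w→u , _) = ⇝-closed-under-InNbr s⇝u w→u
    ...   | inj₂ (u→w , _) = s⇝u ▻ u→w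

    ⇝-along-Walk : ∀ {u t} → s ⇝ u → Walk D u t → s ⇝ t
    ⇝-along-Walk s⇝u here                 = s⇝u
    ⇝-along-Walk s⇝u (step (inj₁ u→v) vt) = ⇝-along-Walk (s⇝u ▻ u→v) vt
    ⇝-along-Walk s⇝u (step (inj₂ v→u) vt) =
      ⇝-along-Walk (⇝-closed-under-InNbr s⇝u v→u) vt

  ⇝-source⇒≡ : ∀ {s t} → Source t → s ⇝ t → s ≡ t
  ⇝-source⇒≡ source ⇝-refl    = refl
  ⇝-source⇒≡ source (_ ▻ u→t) = ⊥-elim (source _ u→t)

  source-unique : Connected D → InTournaments → ∀ {s t} → Source s → Source t → s ≡ t
  source-unique connected inTournaments {s} {t} source-s source-t =
    ⇝-source⇒≡ source-t (⇝-along-Walk inTournaments source-s ⇝-refl (connected s t))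

  equal-InNbr⇒Source : OutTournaments → ∀ {x y} → x ≢ y →
                       (∀ z → InNbr D x z ⇔ InNbr D y z) → Source x
  equal-InNbr⇒Source outTournaments {x} {y} x≢y same z z→x
    with outTournaments z x y z→x (to (same z) z→x) x≢y
  ... | inj₁ (x→y , _) = loopless x (from (same x) x→y)
  ... | inj₂ (y→x , _) = loopless y (to (same y) y→x)

  equal-ClosedInNbr⇒2-cycle : ∀ {x y} → x ≢ y →
                              (∀ z → ClosedInNbr D x z ⇔ ClosedInNbr D y z) →
                              Arc x y × Arc y x
  equal-ClosedInNbr⇒2-cycle {x} {y} x≢y same
    with to (same x) (inj₂ refl) | from (same y) (inj₂ refl)
  ... | inj₂ x≡y | _        = ⊥-elim (x≢y x≡y)
  ... | _        | inj₂ y≡x = ⊥-elim (x≢y (sym y≡x))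
  ... | inj₁ x→y | inj₁ y→x = x→y , y→x

lemma1 : (D : Digraph) → Connected D → LocalTournament D → TwinFree D
lemma1 D connected (simple , tournaments) x y (x≢y , inj₁ same) =
  x≢y (source-unique D connected inTournaments source-x source-y)
  where
  inTournaments : InTournaments D
  inTournaments v = proj₁ (tournaments v)

  outTournaments : OutTournaments D
  outTournaments v = proj₂ (tournaments v)

  source-x : Source D x
  source-x = equal-InNbr⇒Source D outTournaments x≢y same

  source-y : Source D y
  source-y = equal-InNbr⇒Source D outTournaments (≢-sym x≢y) (λ z → ⇔-sym (same z))
lemma1 D connected (simple , _) x y (x≢y , inj₂ same) =
  simple x y (equal-ClosedInNbr⇒2-cycle D x≢y same)
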